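{- Let $m\ge 4$ be even and $n\ge 1$, and let $G=C_m\times P_n$ be the cylindrical grid graph, i.e. the graph with vertex set $\{(i,j): 0\le i\le m-1,\ 0\le j\le n-1\}$ in which $(i,j)$ and $(i',j')$ are adjacent iff either $i=i'$ and $|j-j'|=1$, or $j=j'$ and $i-i'\equiv \pm 1 \pmod m$. Then $G$ (which is bipartite) satisfies the Union Closed Conjecture, i.e. each of its two bipartition classes contains a rare vertex.
   Context: A maximal stable set of a graph is a set of pairwise non-adjacent vertices to which no further vertex can be added while remaining pairwise non-adjacent. A vertex is rare if it lies in at most half of the maximal stable sets of the graph. A bipartite graph is said to satisfy the Union Closed Conjecture if each of its two bipartition classes contains a rare vertex. -}

module Defs where

open import Data.Bool using (Bool; true; false)
open import Data.Bool.Properties using () renaming (_≟_ to _≟ᵇ_)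
open import Data.Nat using (ℕ; zero; suc; _+_; _*_; _≤_; _%_)
open import Data.Nat.Properties using () renaming (_≟_ to _≟ℕ_)
open import Data.Fin using (Fin; toℕ)
open import Data.Fin.Properties using (all?) renaming (_≟_ to _≟F_)
open import Data.Product using (_×_; _,_; ∃)
open import Data.Sum using (_⊎_)
open import Data.Vec using (Vec; []; _∷_; lookup; _[_]≔_)
open import Data.List using (List; [_]; cartesianProductWith; filter; length)
open import Relation.Nullary using (¬_; Dec)
open import Relation.Nullary.Decidable using (_×-dec_; _⊎-dec_; _→-dec_; ¬?)
open import Relation.Binary.PropositionalEquality using (_≡_)

Vertex : ℕ → ℕ → Set
Vertex m n = Fin m × Fin n

SuccMod : (m : ℕ) → Fin m → Fin m → Set
SuccMod m i i' = (suc (toℕ i) ≡ toℕ i') ⊎ ((suc (toℕ i) ≡ m) × (toℕ i' ≡ 0))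

Adj : (m n : ℕ) → Vertex m n → Vertex m n → Set
Adj m n (i , j) (i' , j') =
  ((i ≡ i') × ((suc (toℕ j) ≡ toℕ j') ⊎ (suc (toℕ j') ≡ toℕ j)))
  ⊎ ((j ≡ j') × (SuccMod m i i' ⊎ SuccMod m i' i))

-- A set of vertices, as a 0/1 array indexed by the vertices.
VSet : ℕ → ℕ → Set
VSet m n = Vec (Vec Bool n) m

_∈ᵥ_ : ∀ {m n} → Vertex m n → VSet m n → Set
(i , j) ∈ᵥ S = lookup (lookup S i) j ≡ true

insertV : ∀ {m n} → Vertex m n → VSet m n → VSet m n
insertV (i , j) S = S [ i ]≔ (lookup S i [ j ]≔ true)

Stable : ∀ m n → VSet m n → Set
Stable m n S = ∀ i j i' j' → (i , j) ∈ᵥ S → (i' , j') ∈ᵥ S → ¬ Adj m n (i , j) (i' , j')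

MaximalStable : ∀ m n → VSet m n → Set
MaximalStable m n S =
  Stable m n S × (∀ i j → ¬ ((i , j) ∈ᵥ S) → ¬ Stable m n (insertV (i , j) S))

succMod? : ∀ m i i' → Dec (SuccMod m i i')
succMod? m i i' = (suc (toℕ i) ≟ℕ toℕ i') ⊎-dec ((suc (toℕ i) ≟ℕ m) ×-dec (toℕ i' ≟ℕ 0))

adj? : ∀ m n u v → Dec (Adj m n u v)
adj? m n (i , j) (i' , j') =
  ((i ≟F i') ×-dec ((suc (toℕ j) ≟ℕ toℕ j') ⊎-dec (suc (toℕ j') ≟ℕ toℕ j)))
  ⊎-dec ((j ≟F j') ×-dec (succMod? m i i' ⊎-dec succMod? m i' i))

∈? : ∀ {m n} (v : Vertex m n) S → Dec (v ∈ᵥ S)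
∈? (i , j) S = lookup (lookup S i) j ≟ᵇ true

stable? : ∀ m n S → Dec (Stable m n S)
stable? m n S = all? λ i → all? λ j → all? λ i' → all? λ j' →
  ∈? (i , j) S →-dec ∈? (i' , j') S →-dec ¬? (adj? m n (i , j) (i' , j'))

maximalStable? : ∀ m n S → Dec (MaximalStable m n S)
maximalStable? m n S = stable? m n S ×-dec
  (all? λ i → all? λ j → ¬? (∈? (i , j) S) →-dec ¬? (stable? m n (insertV (i , j) S)))

-- Exhaustive enumeration (each element exactly once) of Vec A k from a list of A
vecsOf : ∀ {A : Set} → List A → (k : ℕ) → List (Vec A k)
vecsOf xs zero = [ [] ]
vecsOf xs (suc k) = cartesianProductWith _∷_ xs (vecsOf xs k)

allVSets : ∀ m n → List (VSet m n)
allVSets m n = vecsOf (vecsOf (true Data.List.∷ false Data.List.∷ Data.List.[]) n) m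

maximalStableSets : ∀ m n → List (VSet m n)
maximalStableSets m n = filter (maximalStable? m n) (allVSets m n)

#MSS : ℕ → ℕ → ℕ
#MSS m n = length (maximalStableSets m n)

#MSS∋ : ∀ m n → Vertex m n → ℕ
#MSS∋ m n v = length (filter (∈? v) (maximalStableSets m n))

Rare : ∀ m n → Vertex m n → Set
Rare m n v = 2 * #MSS∋ m n v ≤ #MSS m n

-- The two bipartition classes of C_m × P_n (m even): parity of i + j.
InClass : ∀ {m n} → ℕ → Vertex m n → Set
InClass c (i , j) = (toℕ i + toℕ j) % 2 ≡ c

SatisfiesUCC : ℕ → ℕ → Set
SatisfiesUCC m n =
  (∃ λ (v : Vertex m n) → InClass 0 v × Rare m n v)
  × (∃ λ (v : Vertex m n) → InClass 1 v × Rare m n v)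

{-# OPTIONS --safe #-}
module Submission where

-- The reflection i ↦ m − 1 − i of the cycle is an involutive automorphism of C_m × P_n
-- exchanging the adjacent vertices (0 , 0) and (m − 1 , 0). Relabelling by it permutes the
-- maximal stable sets, so both vertices lie in equally many of them; being adjacent, they
-- never lie in the same one, so each lies in at most half. Since m is even, the two vertices
-- lie in different bipartition classes.

open import Defs
open import Algebra.Definitions using (Involutive)
open import Data.Bool using (Bool; true; false)
open import Data.Empty using (⊥-elim)
open import Data.Fin using (Fin; toℕ; zero; opposite)
open import Data.Fin.Properties using (toℕ<n; toℕ-fromℕ; opposite-prop; opposite-involutive) renaming (_≟_ to _≟F_)
open import Data.List using (List; []; _∷_; map; filter; length)
open import Data.List.Membership.Propositional using (_∈_)
open import Data.List.Membership.Propositional.Properties using (∈-map⁺; ∈-map⁻; ∈-filter⁺; ∈-filter⁻; ∈-cartesianProductWith⁺)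
open import Data.List.Membership.Propositional.Properties.WithK using (unique∧set⇒bag)
open import Data.List.Properties using (filter-≐)
open import Data.List.Relation.Binary.BagAndSetEquality using (∼bag⇒↭)
open import Data.List.Relation.Binary.Permutation.Propositional using (_↭_)
open import Data.List.Relation.Binary.Permutation.Propositional.Properties using (filter-↭; ↭-length)
open import Data.List.Relation.Unary.All using ([]; _∷_)
open import Data.List.Relation.Unary.AllPairs using ([]; _∷_)
open import Data.List.Relation.Unary.Any using (here; there)
open import Data.List.Relation.Unary.Unique.Propositional using (Unique)
import Data.List.Relation.Unary.Unique.Propositional.Properties as Unique
open import Data.Nat using (ℕ; zero; suc; _+_; _*_; _∸_; _≤_; _%_; z≤n; s≤s)
open import Data.Nat.DivMod using (%-pred-≡0)
open import Data.Nat.Properties using (module ≤-Reasoning; +-∸-assoc; n∸n≡0; +-suc; +-identityʳ; m≤n⇒m≤1+n)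
open import Data.Product using (_×_; _,_; proj₁; proj₂)
open import Data.Product.Properties using (≡-dec)
open import Data.Sum using (_⊎_; inj₁; inj₂)
open import Data.Vec using (Vec; []; _∷_; lookup; tabulate)
open import Data.Vec.Properties using (∷-injective; lookup∘update; lookup∘update′; lookup∘tabulate; tabulate∘lookup; tabulate-cong)
open import Function using (_∘_; mk⇔)
open import Level using (0ℓ)
open import Relation.Binary.Definitions using (DecidableEquality)
open import Relation.Binary.PropositionalEquality using (_≡_; _≢_; refl; sym; trans; cong; cong₂; subst; module ≡-Reasoning)
open import Relation.Nullary using (¬_; yes; no)
open import Relation.Unary using (Pred; Decidable; _≐_)

module _ {A : Set} where

  length-filter-disjoint : {P Q : Pred A 0ℓ} (P? : Decidable P) (Q? : Decidable Q) (xs : List A) →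
    (∀ {x} → x ∈ xs → P x → ¬ Q x) →
    length (filter P? xs) + length (filter Q? xs) ≤ length xs
  length-filter-disjoint P? Q? [] disjoint = z≤n
  length-filter-disjoint P? Q? (x ∷ xs) disjoint
    with P? x | Q? x | length-filter-disjoint P? Q? xs (disjoint ∘ there)
  ... | yes p | yes q | _  = ⊥-elim (disjoint (here refl) p q)
  ... | yes _ | no _  | ih = s≤s ih
  ... | no _  | yes _ | ih rewrite +-suc (length (filter P? xs)) (length (filter Q? xs)) = s≤s ih
  ... | no _  | no _  | ih = m≤n⇒m≤1+n ih

  length-filter-map : {B : Set} {P : Pred B 0ℓ} (P? : Decidable P) (f : A → B) (xs : List A) →
    length (filter P? (map f xs)) ≡ length (filter (P? ∘ f) xs)
  length-filter-map P? f [] = refl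
  length-filter-map P? f (x ∷ xs) with P? (f x)
  ... | yes _ = cong suc (length-filter-map P? f xs)
  ... | no _  = length-filter-map P? f xs

  module _ (f : A → A) (f-involutive : Involutive _≡_ f) {xs : List A} (xs-unique : Unique xs)
           (f-closed : ∀ {x} → x ∈ xs → f x ∈ xs) where

    map-involution-↭ : map f xs ↭ xs
    map-involution-↭ = ∼bag⇒↭ (unique∧set⇒bag (Unique.map⁺ f-injective xs-unique) xs-unique
      (λ {x} → mk⇔ ∈xs (λ x∈xs → subst (_∈ map f xs) (f-involutive x) (∈-map⁺ f (f-closed x∈xs)))))
      where
      f-injective : ∀ {x y} → f x ≡ f y → x ≡ y
      f-injective {x} {y} fx≡fy = trans (sym (f-involutive x)) (trans (cong f fx≡fy) (f-involutive y))

      ∈xs : ∀ {y} → y ∈ map f xs → y ∈ xs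
      ∈xs y∈fxs with _ , x∈xs , refl ← ∈-map⁻ f y∈fxs = f-closed x∈xs

    length-filter-∘-involution : {P : Pred A 0ℓ} (P? : Decidable P) →
      length (filter (P? ∘ f) xs) ≡ length (filter P? xs)
    length-filter-∘-involution P? =
      trans (sym (length-filter-map P? f xs)) (↭-length (filter-↭ P? map-involution-↭))

  ∈-vecsOf : {xs : List A} → (∀ x → x ∈ xs) → (k : ℕ) (v : Vec A k) → v ∈ vecsOf xs k
  ∈-vecsOf complete zero [] = here refl
  ∈-vecsOf complete (suc k) (x ∷ v) = ∈-cartesianProductWith⁺ _∷_ (complete x) (∈-vecsOf complete k v)

  vecsOf-unique : {xs : List A} → Unique xs → (k : ℕ) → Unique (vecsOf xs k)
  vecsOf-unique xs-unique zero = [] ∷ []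
  vecsOf-unique xs-unique (suc k) =
    Unique.cartesianProductWith⁺ _∷_ ∷-injective xs-unique (vecsOf-unique xs-unique k)

∈-allVSets : ∀ {m n} (S : VSet m n) → S ∈ allVSets m n
∈-allVSets {m} {n} = ∈-vecsOf (∈-vecsOf ∈-bools n) m
  where
  ∈-bools : ∀ b → b ∈ true ∷ false ∷ []
  ∈-bools true = here refl
  ∈-bools false = there (here refl)

allVSets-unique : ∀ m n → Unique (allVSets m n)
allVSets-unique m n = vecsOf-unique (vecsOf-unique bools-unique n) m
  where
  bools-unique : Unique (true ∷ false ∷ [])
  bools-unique = ((λ ()) ∷ []) ∷ [] ∷ []

module _ {m n : ℕ} where

  ∈-maximalStableSets⁺ : {S : VSet m n} → MaximalStable m n S → S ∈ maximalStableSets m n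
  ∈-maximalStableSets⁺ {S} = ∈-filter⁺ (maximalStable? m n) (∈-allVSets S)

  ∈-maximalStableSets⁻ : {S : VSet m n} → S ∈ maximalStableSets m n → MaximalStable m n S
  ∈-maximalStableSets⁻ = proj₂ ∘ ∈-filter⁻ (maximalStable? m n) {xs = allVSets m n}

  maximalStableSets-unique : Unique (maximalStableSets m n)
  maximalStableSets-unique = Unique.filter⁺ (maximalStable? m n) (allVSets-unique m n)

  -- v ∈ᵥ S unfolds definitionally to S ‼ v ≡ true.
  _‼_ : VSet m n → Vertex m n → Bool
  S ‼ (i , j) = lookup (lookup S i) j

  _≟ᵥ_ : DecidableEquality (Vertex m n)
  _≟ᵥ_ = ≡-dec _≟F_ _≟F_

  ∈-insertV-self : (v : Vertex m n) (S : VSet m n) → v ∈ᵥ insertV v S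
  ∈-insertV-self (i , j) S =
    trans (cong (λ row → lookup row j) (lookup∘update i S _)) (lookup∘update j (lookup S i) true)

  ‼-insertV-≢ : (S : VSet m n) {v w : Vertex m n} → w ≢ v → insertV v S ‼ w ≡ S ‼ w
  ‼-insertV-≢ S {i , j} {i′ , j′} w≢v with i′ ≟F i
  ... | no i′≢i = cong (λ row → lookup row j′) (lookup∘update′ i′≢i S _)
  ‼-insertV-≢ S {i , j} {.i , j′} w≢v | yes refl =
    trans (cong (λ row → lookup row j′) (lookup∘update i S _)) (lookup∘update′ (w≢v ∘ cong (i ,_)) (lookup S i) true)

  ∈-insertV⁺ : (S : VSet m n) (v w : Vertex m n) → w ∈ᵥ S → w ∈ᵥ insertV v S
  ∈-insertV⁺ S v w w∈S with w ≟ᵥ v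
  ... | yes refl = ∈-insertV-self v S
  ... | no w≢v = trans (‼-insertV-≢ S w≢v) w∈S

  ∈-insertV⁻ : (S : VSet m n) (v w : Vertex m n) → w ∈ᵥ insertV v S → w ≡ v ⊎ w ∈ᵥ S
  ∈-insertV⁻ S v w w∈S+v with w ≟ᵥ v
  ... | yes w≡v = inj₁ w≡v
  ... | no w≢v = inj₂ (trans (sym (‼-insertV-≢ S w≢v)) w∈S+v)

  adjacent-equally-frequent⇒rare : {u v : Vertex m n} → Adj m n u v → #MSS∋ m n u ≡ #MSS∋ m n v →
    Rare m n u × Rare m n v
  adjacent-equally-frequent⇒rare {u} {v} u~v #u≡#v =
    (begin 2 * #u       ≡⟨ cong₂ _+_ refl (trans (+-identityʳ #u) #u≡#v) ⟩
           #u + #v     ≤⟨ #u+#v≤#MSS ⟩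
           #MSS m n    ∎) ,
    (begin 2 * #v       ≡⟨ cong₂ _+_ (sym #u≡#v) (+-identityʳ #v) ⟩
           #u + #v     ≤⟨ #u+#v≤#MSS ⟩
           #MSS m n    ∎)
    where
    open ≤-Reasoning
    #u = #MSS∋ m n u
    #v = #MSS∋ m n v
    #u+#v≤#MSS : #u + #v ≤ #MSS m n
    #u+#v≤#MSS = length-filter-disjoint (∈? u) (∈? v) (maximalStableSets m n)
      (λ S∈ u∈S v∈S → proj₁ (∈-maximalStableSets⁻ S∈) _ _ _ _ u∈S v∈S u~v)

module InvolutiveAutomorphism {m n : ℕ} (φ : Vertex m n → Vertex m n) (φ-involutive : Involutive _≡_ φ)
         (φ-adj : ∀ {u v} → Adj m n u v → Adj m n (φ u) (φ v)) where

  relabel : VSet m n → VSet m n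
  relabel S = tabulate λ i → tabulate λ j → S ‼ φ (i , j)

  relabel-‼ : (S : VSet m n) (v : Vertex m n) → relabel S ‼ v ≡ S ‼ φ v
  relabel-‼ S (i , j) = trans (cong (λ row → lookup row j) (lookup∘tabulate _ i)) (lookup∘tabulate _ j)

  ∈-relabel⁺ : (S : VSet m n) (v : Vertex m n) → φ v ∈ᵥ S → v ∈ᵥ relabel S
  ∈-relabel⁺ S v = trans (relabel-‼ S v)

  ∈-relabel⁻ : (S : VSet m n) (v : Vertex m n) → v ∈ᵥ relabel S → φ v ∈ᵥ S
  ∈-relabel⁻ S v = trans (sym (relabel-‼ S v))

  relabel-involutive : Involutive _≡_ relabel
  relabel-involutive S = begin
    relabel (relabel S)                             ≡⟨ tabulate-cong (λ i → tabulate-cong (λ j →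
                                                         relabel²-‼ (i , j))) ⟩
    tabulate (λ i → tabulate (lookup (lookup S i))) ≡⟨ tabulate-cong (λ i → tabulate∘lookup (lookup S i)) ⟩
    tabulate (lookup S)                             ≡⟨ tabulate∘lookup S ⟩
    S                                               ∎
    where
    open ≡-Reasoning
    relabel²-‼ : ∀ v → relabel S ‼ φ v ≡ S ‼ v
    relabel²-‼ v = trans (relabel-‼ S (φ v)) (cong (S ‼_) (φ-involutive v))

  Stable-pullback : (S T : VSet m n) → (∀ v → v ∈ᵥ T → φ v ∈ᵥ S) → Stable m n S → Stable m n T
  Stable-pullback S T T⇒S S-stable i j i′ j′ v∈T w∈T v~w =
    S-stable _ _ _ _ (T⇒S (i , j) v∈T) (T⇒S (i′ , j′) w∈T) (φ-adj {i , j} {i′ , j′} v~w)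

  ∈-insertV-relabel : (S : VSet m n) (v w : Vertex m n) →
    w ∈ᵥ insertV (φ v) S → φ w ∈ᵥ insertV v (relabel S)
  ∈-insertV-relabel S v w w∈S+φv with ∈-insertV⁻ S (φ v) w w∈S+φv
  ... | inj₁ refl = subst (_∈ᵥ insertV v (relabel S)) (sym (φ-involutive v)) (∈-insertV-self v (relabel S))
  ... | inj₂ w∈S  = ∈-insertV⁺ (relabel S) v (φ w) (∈-relabel⁺ S (φ w) (subst (_∈ᵥ S) (sym (φ-involutive w)) w∈S))

  MaximalStable-relabel : {S : VSet m n} → MaximalStable m n S → MaximalStable m n (relabel S)
  MaximalStable-relabel {S} (S-stable , S-maximal) = Stable-pullback S (relabel S) (∈-relabel⁻ S) S-stable , maximal
    where
    maximal : ∀ i j → ¬ (i , j) ∈ᵥ relabel S → ¬ Stable m n (insertV (i , j) (relabel S))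
    maximal i j v∉ v+stable = S-maximal (proj₁ (φ (i , j))) (proj₂ (φ (i , j))) (v∉ ∘ ∈-relabel⁺ S (i , j))
      (Stable-pullback (insertV (i , j) (relabel S)) (insertV (φ (i , j)) S) (∈-insertV-relabel S (i , j)) v+stable)

  #MSS∋-invariant : (v : Vertex m n) → #MSS∋ m n (φ v) ≡ #MSS∋ m n v
  #MSS∋-invariant v = begin
    length (filter (∈? (φ v)) MSS)        ≡⟨ cong length (filter-≐ (∈? (φ v)) (∈? v ∘ relabel) φv∈≐∈relabel MSS) ⟩
    length (filter (∈? v ∘ relabel) MSS)  ≡⟨ length-filter-∘-involution relabel relabel-involutive
                                               maximalStableSets-unique relabel-closed (∈? v) ⟩
    length (filter (∈? v) MSS)            ∎
    where
    open ≡-Reasoning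
    MSS = maximalStableSets m n
    φv∈≐∈relabel : (φ v ∈ᵥ_) ≐ ((v ∈ᵥ_) ∘ relabel)
    φv∈≐∈relabel = (λ {S} → ∈-relabel⁺ S v) , (λ {S} → ∈-relabel⁻ S v)
    relabel-closed : ∀ {S} → S ∈ maximalStableSets m n → relabel S ∈ maximalStableSets m n
    relabel-closed {S} = ∈-maximalStableSets⁺ ∘ MaximalStable-relabel {S} ∘ ∈-maximalStableSets⁻

  swapped-edge⇒rare : {v : Vertex m n} → Adj m n v (φ v) → Rare m n v × Rare m n (φ v)
  swapped-edge⇒rare {v} v~φv = adjacent-equally-frequent⇒rare v~φv (sym (#MSS∋-invariant v))

suc-toℕ-opposite : ∀ {m} (i : Fin m) → suc (toℕ (opposite i)) ≡ m ∸ toℕ i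
suc-toℕ-opposite i = trans (cong suc (opposite-prop i)) (sym (+-∸-assoc 1 (toℕ<n i)))

SuccMod-opposite : ∀ {m} {i i′ : Fin m} → SuccMod m i i′ → SuccMod m (opposite i′) (opposite i)
SuccMod-opposite {m} {i} {i′} (inj₁ 1+i≡i′) = inj₁ (begin
  suc (toℕ (opposite i′)) ≡⟨ suc-toℕ-opposite i′ ⟩
  m ∸ toℕ i′              ≡⟨ cong (m ∸_) 1+i≡i′ ⟨
  m ∸ suc (toℕ i)         ≡⟨ opposite-prop i ⟨
  toℕ (opposite i)        ∎)
  where open ≡-Reasoning
SuccMod-opposite {m} {i} {i′} (inj₂ (1+i≡m , i′≡0)) =
  inj₂ (trans (suc-toℕ-opposite i′) (cong (m ∸_) i′≡0) , (begin
  toℕ (opposite i) ≡⟨ opposite-prop i ⟩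
  m ∸ suc (toℕ i)  ≡⟨ cong (m ∸_) 1+i≡m ⟩
  m ∸ m            ≡⟨ n∸n≡0 m ⟩
  0                ∎))
  where open ≡-Reasoning

module _ {m n : ℕ} where

  reflect : Vertex m n → Vertex m n
  reflect (i , j) = opposite i , j

  reflect-involutive : Involutive _≡_ reflect
  reflect-involutive (i , j) = cong (_, j) (opposite-involutive i)

  Adj-reflect : ∀ {u v} → Adj m n u v → Adj m n (reflect u) (reflect v)
  Adj-reflect (inj₁ (i≡i′ , j~j′)) = inj₁ (cong opposite i≡i′ , j~j′)
  Adj-reflect (inj₂ (j≡j′ , inj₁ i→i′)) = inj₂ (j≡j′ , inj₂ (SuccMod-opposite i→i′))
  Adj-reflect (inj₂ (j≡j′ , inj₂ i′→i)) = inj₂ (j≡j′ , inj₁ (SuccMod-opposite i′→i))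

proposition3 : (m n : ℕ) → 4 ≤ m → m % 2 ≡ 0 → 1 ≤ n → SatisfiesUCC m n
proposition3 zero n () _ _
proposition3 (suc m) zero _ _ ()
proposition3 (suc m) (suc n) _ 1+m-even _ =
  (origin , refl , proj₁ both-rare) , (reflect origin , reflect-origin-odd , proj₂ both-rare)
  where
  origin : Vertex (suc m) (suc n)
  origin = zero , zero

  wrap-edge : Adj (suc m) (suc n) origin (reflect origin)
  wrap-edge = inj₂ (refl , inj₂ (inj₂ (cong suc (toℕ-fromℕ m) , refl)))

  both-rare : Rare (suc m) (suc n) origin × Rare (suc m) (suc n) (reflect origin)
  both-rare = InvolutiveAutomorphism.swapped-edge⇒rare reflect reflect-involutive Adj-reflect wrap-edge

  reflect-origin-odd : InClass 1 (reflect origin)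
  reflect-origin-odd = trans (cong (_% 2) (trans (+-identityʳ _) (toℕ-fromℕ m))) (%-pred-≡0 {m} 1+m-even)
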